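{- Let $B=(X,Y,E)$ be an ACB graph. Then $split_X(B)$ is an interval graph if and only if $B$ contains no induced $X$-$P_7$.
   Context: Bipartite graph $B=(X,Y,E)$ with color classes $X,Y$; mirror $mir(B)$ has the same color classes and $xy$ ($x\in X,y\in Y$) is an edge iff it is not an edge of $B$; chordal bipartite means no induced chordless cycle $C_{2k}$, $k\ge3$; $B$ is ACB if $B$ and $mir(B)$ are chordal bipartite. $split_X(B)$ is obtained from $B$ by adding all edges among vertices of $X$. An $X$-$P_7$ is an induced chordless path on 7 vertices in $B$ with both end-vertices in $X$. -}

module Defs where

open import Data.Nat using (ℕ; zero; suc; _+_; _≤_)
open import Data.Fin using (Fin; toℕ)
open import Data.Bool using (Bool; true; false; not)
open import Data.Sum using (_⊎_; inj₁; inj₂)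
open import Data.Product using (Σ; _×_; ∃; ∃-syntax)
open import Data.Empty using (⊥)
open import Relation.Nullary using (¬_)
open import Relation.Binary.PropositionalEquality using (_≡_; _≢_)
open import Function.Bundles using (_⇔_)
open import Function.Definitions using (Injective)

record Graph : Set₁ where
  field
    V   : Set
    Adj : V → V → Set
open Graph public

-- A finite bipartite graph B = (X, Y, E) with X = Fin m, Y = Fin n;
-- E x y = true iff xy is an edge.
record Bipartite : Set where
  field
    m n : ℕ
    E   : Fin m → Fin n → Bool
open Bipartite public

mir : Bipartite → Bipartite
mir B = record { m = m B ; n = n B ; E = λ x y → not (E B x y) }

bipAdj : (B : Bipartite) → Fin (m B) ⊎ Fin (n B) → Fin (m B) ⊎ Fin (n B) → Set
bipAdj B (inj₁ x) (inj₂ y) = E B x y ≡ true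
bipAdj B (inj₂ y) (inj₁ x) = E B x y ≡ true
bipAdj B (inj₁ _) (inj₁ _) = ⊥
bipAdj B (inj₂ _) (inj₂ _) = ⊥

graphOf : Bipartite → Graph
graphOf B = record { V = Fin (m B) ⊎ Fin (n B) ; Adj = bipAdj B }

splitAdj : (B : Bipartite) → Fin (m B) ⊎ Fin (n B) → Fin (m B) ⊎ Fin (n B) → Set
splitAdj B (inj₁ x) (inj₁ x') = x ≢ x'
splitAdj B u v = bipAdj B u v

splitX : Bipartite → Graph
splitX B = record { V = Fin (m B) ⊎ Fin (n B) ; Adj = splitAdj B }

CycNext : (L : ℕ) → Fin L → Fin L → Set
CycNext L i j = (suc (toℕ i) ≡ toℕ j) ⊎ ((suc (toℕ i) ≡ L) × (toℕ j ≡ 0))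

CycAdj : (L : ℕ) → Fin L → Fin L → Set
CycAdj L i j = CycNext L i j ⊎ CycNext L j i

PathAdj : (L : ℕ) → Fin L → Fin L → Set
PathAdj L i j = (suc (toℕ i) ≡ toℕ j) ⊎ (suc (toℕ j) ≡ toℕ i)

InducedCycle : (G : Graph) → ℕ → Set
InducedCycle G L = Σ (Fin L → V G) λ c →
  Injective _≡_ _≡_ c × (∀ i j → Adj G (c i) (c j) ⇔ CycAdj L i j)

InducedPath : (G : Graph) → ℕ → Set
InducedPath G L = Σ (Fin L → V G) λ c →
  Injective _≡_ _≡_ c × (∀ i j → Adj G (c i) (c j) ⇔ PathAdj L i j)

ChordalBipartite : Bipartite → Set
ChordalBipartite B = ∀ k → 3 ≤ k → ¬ InducedCycle (graphOf B) (k + k)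

ACB : Bipartite → Set
ACB B = ChordalBipartite B × ChordalBipartite (mir B)

XP7 : (B : Bipartite) → Set
XP7 B = Σ (InducedPath (graphOf B) 7) λ p →
  (∃[ x ] Data.Product.proj₁ p Fin.zero ≡ inj₁ x) ×
  (∃[ x' ] Data.Product.proj₁ p (Fin.suc (Fin.suc (Fin.suc (Fin.suc (Fin.suc (Fin.suc Fin.zero)))))) ≡ inj₁ x')
  where import Data.Fin as Fin
        import Data.Product

-- Interval graph: every vertex v gets a closed interval [l v, r v] (ℕ endpoints,
-- which suffices for finite graphs), and two distinct vertices are adjacent iff
-- their intervals intersect.
IsIntervalGraph : Graph → Set
IsIntervalGraph G = Σ (V G → ℕ) λ l → Σ (V G → ℕ) λ r →
  (∀ v → l v ≤ r v) ×
  (∀ u v → u ≢ v → Adj G u v ⇔ (l u ≤ r v × l v ≤ r u))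

-- (⇒) In an interval model of split_X(B) the X-intervals pairwise meet and the
-- Y-intervals are pairwise disjoint. In an X-P₇ x₀ y₀ x₁ y₁ x₂ y₂ x₃ one of y₀, y₁, y₂
-- lies between the other two, and two distinct x's see the outer ones but not the
-- middle one; since their intervals meet, one of them covers the middle interval.
--
-- (⇐) Order Y by inclusion of neighbourhoods. Three pairwise incomparable
-- neighbourhoods yield an induced 3K₂ (whose mirror is C₆), a C₆ or an X-P₇, so the
-- order has width ≤ 2, and a greedy pass along a linear extension covers it by two
-- chains. Laying out one chain left of a point D in increasing order and the other
-- right of D in decreasing order makes every X-neighbourhood an interval around D.

module Submission where

open import Defs
open import Data.Bool using (Bool; true; false; not; if_then_else_)
open import Data.Bool.Properties using (¬-not; not-¬; not-involutive; ⇔→≡)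
  renaming (_≟_ to _≟ᵇ_)
open import Data.Empty using (⊥; ⊥-elim)
open import Data.Fin using (Fin; zero; suc; toℕ; combine; fromℕ<; #_) renaming (_≟_ to _≟ᶠ_)
open import Data.Fin.Properties
  using (all?; any?; ¬∀⟶∃¬; toℕ<n; toℕ-injective; toℕ-fromℕ<; combine-injectiveʳ; combine-monoˡ-<)
open import Data.Fin.Subset using (Subset; _∈_; _∉_; _⊆_; _⊈_)
open import Data.Fin.Subset.Properties
  using (_∈?_; _⊆?_; ⊆-refl; ⊆-trans; ∣p∣≤n; p⊂q⇒∣p∣<∣q∣)
open import Data.Vec.Properties using (lookup∘tabulate; []=⇒lookup; lookup⇒[]=)
open import Data.Nat using (ℕ; zero; suc; _+_; _*_; _∸_; _≤_; _<_; _≤?_; _<?_; _≟_; z≤n; s≤s)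
open import Data.Nat.Properties
  using (≤-refl; ≤-reflexive; ≤-trans; ≤-antisym; <-≤-trans; <-asym; <-irrefl; <-trans; <⇒≤; ≰⇒>
        ; m<n⇒m<1+n; m<1+n⇒m<n∨m≡n; m≤n⇒m<n∨m≡n
        ; m+n∸n≡m; m≤m+n; ∸-monoʳ-≤; ∸-cancelʳ-≤; ∸-cancelˡ-≡)
open import Data.Product using (Σ; _×_; _,_; proj₁; proj₂; ∃; swap)
import Data.Product as Product
open import Data.Sum using (_⊎_; inj₁; inj₂)
import Data.Sum as Sum
open import Data.Sum.Properties using (inj₁-injective; inj₂-injective; ≡-dec)
open import Data.Vec using (Vec; []; _∷_; lookup; tabulate)
open import Function using (_∘_; const; case_of_)
import Data.List as List
import Data.List.Relation.Unary.All as ListAll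
import Data.List.Relation.Unary.All.Properties as ListAll
open import Data.List.Membership.Propositional.Properties using (∈-tabulate⁺)
open import Data.List.Extrema.Nat using (max; xs≤max; max≤v⁺)
open import Data.Maybe using (Maybe; just; nothing)
open import Data.Maybe.Relation.Unary.All using (All; just; nothing)
open import Data.Maybe.Relation.Unary.Any using (Any; just)
import Data.Maybe.Relation.Unary.All as All
open import Function.Bundles using (_⇔_; mk⇔; Equivalence)
open import Function.Definitions using (Injective)
import Function.Properties.Equivalence as ⇔
open import Relation.Binary.PropositionalEquality
open import Relation.Nullary using (¬_; Dec; yes; no; does)
open import Relation.Nullary.Decidable using (dec-true; dec-false; from-yes; map′; _×-dec_; _→-dec_; _⊎-dec_)

open Equivalence using (to; from)

_⇔?_ : {A B : Set} → Dec A → Dec B → Dec (A ⇔ B)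
a? ⇔? b? = map′ (λ (f , g) → mk⇔ f g) (λ e → to e , from e) ((a? →-dec b?) ×-dec (b? →-dec a?))

module _ {A : Set} (_≼_ : A → A → Set) where

  Incomparable : A → A → Set
  Incomparable u v = ¬ u ≼ v × ¬ v ≼ u

  Width≤2 : Set
  Width≤2 = ∀ u v w → Incomparable u v → Incomparable v w → Incomparable u w → ⊥

module TwoChains
  {N : ℕ} (_≼_ : Fin N → Fin N → Set) (_≼?_ : ∀ p q → Dec (p ≼ q))
  (≼-refl : ∀ {p} → p ≼ p) (≼-trans : ∀ {p q r} → p ≼ q → q ≼ r → p ≼ r)
  (width≤2 : Width≤2 _≼_)
  (rank : Fin N → ℕ) (rank-injective : ∀ {p q} → rank p ≡ rank q → p ≡ q)
  (rank-linear : ∀ {p q} → rank p < rank q → q ≼ p → p ≼ q)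
  where

  rank-incomparable : ∀ {p q} → rank p < rank q → ¬ p ≼ q → Incomparable _≼_ p q
  rank-incomparable rp<rq p⋠q = p⋠q , p⋠q ∘ rank-linear rp<rq

  Done : ℕ → Fin N → Set
  Done t p = rank p < t

  -- The greedy state once the elements of rank < t are placed; top c is the
  -- current maximum of chain c.
  record Partial (t : ℕ) : Set where
    field
      colour     : Fin N → Bool
      top        : Bool → Maybe (Fin N)
      chain      : ∀ {p q} → Done t p → Done t q → colour p ≡ colour q → p ≼ q ⊎ q ≼ p
      under-top  : ∀ {p} → Done t p → Any (p ≼_) (top (colour p))
      top-done   : ∀ c → All (Done t) (top c)
      extendable : ∀ {w} → t ≤ rank w → ∃ λ c → All (_≼ w) (top c)

  empty : Partial 0
  empty = record
    { colour = λ _ → true ; top = λ _ → nothing ; chain = λ () ; under-top = λ ()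
    ; top-done = λ _ → nothing ; extendable = λ _ → true , nothing }

  below-top : ∀ {p z m} → Any (p ≼_) m → All (_≼ z) m → p ≼ z
  below-top (just p≼a) (just a≼z) = ≼-trans p≼a a≼z

  skip : ∀ {t} → Partial t → (∀ p → rank p ≢ t) → Partial (suc t)
  skip {t} S none = record
    { colour = colour ; top = top
    ; chain = λ p q → chain (earlier p) (earlier q) ; under-top = under-top ∘ earlier
    ; top-done = λ c → All.map m<n⇒m<1+n (top-done c)
    ; extendable = λ t<w → extendable (<⇒≤ t<w) }
    where
    open Partial S
    earlier : ∀ {p} → Done (suc t) p → Done t p
    earlier {p} p<1+t with m<1+n⇒m<n∨m≡n p<1+t
    ... | inj₁ p<t = p<t
    ... | inj₂ p≡t = ⊥-elim (none p p≡t)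

  module Step {t} (S : Partial t) (z : Fin N) (rz≡t : rank z ≡ t) where
    open Partial S

    -- Putting z on chain c is safe if every later element still fits on top of a chain.
    Safe : Bool → Set
    Safe c = ∀ w → t < rank w → z ≼ w ⊎ All (_≼ w) (top (not c))

    safeAt? : ∀ c w → Dec (t < rank w → z ≼ w ⊎ All (_≼ w) (top (not c)))
    safeAt? c w = (t <? rank w) →-dec (z ≼? w ⊎-dec All.dec (_≼? w) (top (not c)))

    safe? : ∀ c → Dec (Safe c)
    safe? c = all? (safeAt? c)

    unsafe-witness : ∀ {c} → ¬ Safe c → ∃ λ w → t < rank w × ¬ z ≼ w × ¬ All (_≼ w) (top (not c))
    unsafe-witness {c} unsafe with ¬∀⟶∃¬ N _ (safeAt? c) unsafe
    ... | w , ¬safe-w with t <? rank w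
    ...   | yes t<w = w , t<w , ¬safe-w ∘ const ∘ inj₁ , ¬safe-w ∘ const ∘ inj₂
    ...   | no t≮w  = ⊥-elim (¬safe-w (⊥-elim ∘ t≮w))

    z<later : ∀ {w} → t < rank w → rank z < rank w
    z<later t<w = subst (_< _) (sym rz≡t) t<w

    other-under : ∀ {w} → t ≤ rank w → ∀ c → ¬ All (_≼ w) (top c) → All (_≼ w) (top (not c))
    other-under {w} t≤w c ¬c≼w with extendable t≤w
    ... | c′ , c′≼w with c′ ≟ᵇ c
    ...   | yes refl = ⊥-elim (¬c≼w c′≼w)
    ...   | no c′≢c  = subst (λ b → All (_≼ w) (top b)) (¬-not c′≢c) c′≼w

    -- If c is unsafe, the maximum b of the other chain lies below z: otherwise b, z
    -- and the witness w of unsafety would be pairwise incomparable.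
    unsafe⇒other-under-z : ∀ c → ¬ Safe c → All (_≼ z) (top (not c))
    unsafe⇒other-under-z c unsafe with unsafe-witness unsafe
    ... | w , t<w , z⋠w , ¬other≼w with top (not c) | top-done (not c)
    ...   | nothing | _ = nothing
    ...   | just b  | just b<t with b ≼? z
    ...     | yes b≼z = just b≼z
    ...     | no b⋠z  = ⊥-elim (width≤2 b z w
                          (rank-incomparable (subst (_ <_) (sym rz≡t) b<t) b⋠z)
                          (rank-incomparable (z<later t<w) z⋠w)
                          (rank-incomparable (<-trans b<t t<w) (¬other≼w ∘ just)))

    both-unsafe⇒antichain : ∀ c → ¬ Safe c → ¬ Safe (not c) → ⊥
    both-unsafe⇒antichain c unsafe unsafe′ with unsafe-witness unsafe | unsafe-witness unsafe′
    ... | w , t<w , z⋠w , ¬other≼w | w′ , t<w′ , z⋠w′ , ¬this≼w′ =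
      width≤2 z w w′ (rank-incomparable (z<later t<w) z⋠w) (w⋠w′ , w′⋠w)
                     (rank-incomparable (z<later t<w′) z⋠w′)
      where
      this≼w : All (_≼ w) (top c)
      this≼w = subst (λ b → All (_≼ w) (top b)) (not-involutive c)
                     (other-under (<⇒≤ t<w) (not c) ¬other≼w)
      other≼w′ : All (_≼ w′) (top (not c))
      other≼w′ = other-under (<⇒≤ t<w′) c
                   (¬this≼w′ ∘ subst (λ b → All (_≼ w′) (top b)) (sym (not-involutive c)))
      w⋠w′ : ¬ w ≼ w′
      w⋠w′ w≼w′ = ¬this≼w′ (subst (λ b → All (_≼ w′) (top b)) (sym (not-involutive c))
                               (All.map (λ a≼w → ≼-trans a≼w w≼w′) this≼w))
      w′⋠w : ¬ w′ ≼ w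
      w′⋠w w′≼w = ¬other≼w (All.map (λ b≼w′ → ≼-trans b≼w′ w′≼w) other≼w′)

    choose : ∃ λ c → All (_≼ z) (top c) × Safe c
    choose with extendable (≤-reflexive (sym rz≡t))
    ... | c , c≼z with safe? c
    ...   | yes safe = c , c≼z , safe
    ...   | no unsafe with safe? (not c)
    ...     | yes safe′  = not c , unsafe⇒other-under-z c unsafe , safe′
    ...     | no unsafe′ = ⊥-elim (both-unsafe⇒antichain c unsafe unsafe′)

    done-or-z : ∀ {p} → Done (suc t) p → Done t p ⊎ p ≡ z
    done-or-z {p} p<1+t with m<1+n⇒m<n∨m≡n p<1+t
    ... | inj₁ p<t = inj₁ p<t
    ... | inj₂ p≡t = inj₂ (rank-injective (trans p≡t (sym rz≡t)))

    done⇒≢z : ∀ {p} → Done t p → p ≢ z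
    done⇒≢z p<t refl = <-irrefl rz≡t p<t

    module Place (c : Bool) (c≼z : All (_≼ z) (top c)) (safe : Safe c) where

      colour′ : Fin N → Bool
      colour′ p = if does (p ≟ᶠ z) then c else colour p

      top′ : Bool → Maybe (Fin N)
      top′ c′ = if does (c′ ≟ᵇ c) then just z else top c′

      colour′-z : colour′ z ≡ c
      colour′-z = cong (if_then c else colour z) (dec-true (z ≟ᶠ z) refl)

      colour′-old : ∀ {p} → Done t p → colour′ p ≡ colour p
      colour′-old {p} p<t = cong (if_then c else colour p) (dec-false (p ≟ᶠ z) (done⇒≢z p<t))

      top′-c : top′ c ≡ just z
      top′-c = cong (if_then just z else top c) (dec-true (c ≟ᵇ c) refl)

      top′-other : ∀ {c′} → c′ ≢ c → top′ c′ ≡ top c′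
      top′-other {c′} c′≢c = cong (if_then just z else top c′) (dec-false (c′ ≟ᵇ c) c′≢c)

      old-under-z : ∀ {p} → Done t p → colour p ≡ c → p ≼ z
      old-under-z p<t refl = below-top (under-top p<t) c≼z

      coloured-like-z : ∀ {p} → Done t p → colour′ p ≡ colour′ z → colour p ≡ c
      coloured-like-z p<t same = trans (sym (colour′-old p<t)) (trans same colour′-z)

      chain′ : ∀ {p q} → Done (suc t) p → Done (suc t) q →
               colour′ p ≡ colour′ q → p ≼ q ⊎ q ≼ p
      chain′ p q same with done-or-z p | done-or-z q
      ... | inj₂ refl | inj₂ refl = inj₁ ≼-refl
      ... | inj₁ p<t  | inj₂ refl = inj₁ (old-under-z p<t (coloured-like-z p<t same))
      ... | inj₂ refl | inj₁ q<t  = inj₂ (old-under-z q<t (coloured-like-z q<t (sym same)))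
      ... | inj₁ p<t  | inj₁ q<t  =
        chain p<t q<t (trans (sym (colour′-old p<t)) (trans same (colour′-old q<t)))

      under-top′ : ∀ {p} → Done (suc t) p → Any (p ≼_) (top′ (colour′ p))
      under-top′ {p} p<1+t with done-or-z p<1+t
      ... | inj₂ refl = subst (Any (z ≼_)) (sym (trans (cong top′ colour′-z) top′-c)) (just ≼-refl)
      ... | inj₁ p<t with colour p ≟ᵇ c
      ...   | yes pc≡c = subst (Any (p ≼_))
                               (sym (trans (cong top′ (trans (colour′-old p<t) pc≡c)) top′-c))
                               (just (old-under-z p<t pc≡c))
      ...   | no pc≢c  = subst (Any (p ≼_)) (sym (trans (cong top′ (colour′-old p<t)) (top′-other pc≢c)))
                               (under-top p<t)

      top-done′ : ∀ c′ → All (Done (suc t)) (top′ c′)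
      top-done′ c′ with c′ ≟ᵇ c
      ... | yes refl = just (≤-reflexive (cong suc rz≡t))
      ... | no _     = All.map m<n⇒m<1+n (top-done c′)

      extendable′ : ∀ {w} → suc t ≤ rank w → ∃ λ c′ → All (_≼ w) (top′ c′)
      extendable′ {w} t<w with safe w t<w
      ... | inj₁ z≼w   = c , subst (All (_≼ w)) (sym top′-c) (just z≼w)
      ... | inj₂ oth≼w = not c , subst (All (_≼ w)) (sym (top′-other (not-¬ refl ∘ sym))) oth≼w

      next : Partial (suc t)
      next = record
        { colour = colour′ ; top = top′ ; chain = chain′ ; under-top = under-top′
        ; top-done = top-done′ ; extendable = extendable′ }

    next : Partial (suc t)
    next = Place.next (proj₁ choose) (proj₁ (proj₂ choose)) (proj₂ (proj₂ choose))

  partial : ∀ t → Partial t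
  partial zero = empty
  partial (suc t) with any? (λ z → rank z ≟ t)
  ... | yes (z , rz≡t) = Step.next (partial t) z rz≡t
  ... | no none        = skip (partial t) λ p rp≡t → none (p , rp≡t)

  module _ (D : ℕ) (rank< : ∀ p → rank p < D) where

    twoChainCover : Σ (Fin N → Bool) λ colour → ∀ p q → colour p ≡ colour q → p ≼ q ⊎ q ≼ p
    twoChainCover = colour , λ p q → chain (rank< p) (rank< q)
      where open Partial (partial D)

    chains-monotone : ∀ {p q} → proj₁ twoChainCover p ≡ proj₁ twoChainCover q →
                      rank p ≤ rank q → p ≼ q
    chains-monotone {p} {q} same rp≤rq with m≤n⇒m<n∨m≡n rp≤rq
    ... | inj₂ rp≡rq rewrite rank-injective rp≡rq = ≼-refl
    ... | inj₁ rp<rq with proj₂ twoChainCover p q same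
    ...   | inj₁ p≼q = p≼q
    ...   | inj₂ q≼p = rank-linear rp<rq q≼p

⊈-witness : ∀ {k} {p q : Subset k} → p ⊈ q → ∃ λ x → x ∈ p × x ∉ q
⊈-witness {k} {p} {q} p⊈q
  with ¬∀⟶∃¬ k _ (λ x → x ∈? p →-dec x ∈? q) (λ p⊆q → p⊈q (p⊆q _))
... | x , x∈p⇏x∈q with x ∈? p
...   | yes x∈p = x , x∈p , λ x∈q → x∈p⇏x∈q λ _ → x∈q
...   | no x∉p  = ⊥-elim (x∈p⇏x∈q λ x∈p → ⊥-elim (x∉p x∈p))

maxOver : ∀ {k} → (Fin k → ℕ) → ℕ
maxOver f = max 0 (List.tabulate f)

≤-maxOver : ∀ {k} (f : Fin k → ℕ) i → f i ≤ maxOver f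
≤-maxOver f i = ListAll.lookup (xs≤max 0 (List.tabulate f)) (∈-tabulate⁺ i)

maxOver-lub : ∀ {k} {f : Fin k → ℕ} {b} → (∀ i → f i ≤ b) → maxOver f ≤ b
maxOver-lub f≤b = max≤v⁺ z≤n (ListAll.tabulate⁺ f≤b)

record InducedSubgraph (G H : Graph) : Set where
  field
    embed           : V G → V H
    embed-injective : Injective _≡_ _≡_ embed
    embed-adj       : ∀ u v → Adj H (embed u) (embed v) ⇔ Adj G u v

  cycle : ∀ {L} → InducedCycle G L → InducedCycle H L
  cycle (c , c-injective , c-adj) =
    embed ∘ c , (λ eq → c-injective (embed-injective eq)) ,
    λ i j → ⇔.trans (embed-adj (c i) (c j)) (c-adj i j)

  path : ∀ {L} → InducedPath G L → InducedPath H L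
  path (c , c-injective , c-adj) =
    embed ∘ c , (λ eq → c-injective (embed-injective eq)) ,
    λ i j → ⇔.trans (embed-adj (c i) (c j)) (c-adj i j)

record Occurrence (P B : Bipartite) : Set where
  field
    xmap : Fin (m P) → Fin (m B)
    ymap : Fin (n P) → Fin (n B)
    adjacency : ∀ i j → E B (xmap i) (ymap j) ≡ E P i j

TwinFree : Bipartite → Set
TwinFree P = (∀ i i' → (∀ j → E P i j ≡ E P i' j) → i ≡ i')
           × (∀ j j' → (∀ i → E P i j ≡ E P i j') → j ≡ j')

twinFree? : ∀ P → Dec (TwinFree P)
twinFree? P =
  all? (λ i → all? λ i' → all? (λ j → E P i j ≟ᵇ E P i' j) →-dec (i ≟ᶠ i'))
  ×-dec all? (λ j → all? λ j' → all? (λ i → E P i j ≟ᵇ E P i j') →-dec (j ≟ᶠ j'))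

mirror : ∀ {P B} → Occurrence P B → Occurrence (mir P) (mir B)
mirror occ = record { xmap = xmap ; ymap = ymap ; adjacency = λ i j → cong not (adjacency i j) }
  where open Occurrence occ

module _ {P B : Bipartite} (twinFree : TwinFree P) (occ : Occurrence P B) where
  open Occurrence occ

  occurrence-induced : InducedSubgraph (graphOf P) (graphOf B)
  occurrence-induced = record
    { embed = Sum.map xmap ymap ; embed-injective = injective ; embed-adj = adj }
    where
    injective : Injective _≡_ _≡_ (Sum.map xmap ymap)
    injective {inj₁ i} {inj₁ i'} eq = cong inj₁ (proj₁ twinFree i i' λ j →
      trans (sym (adjacency i j)) (trans (cong (λ x → E B x (ymap j)) (inj₁-injective eq)) (adjacency i' j)))
    injective {inj₂ j} {inj₂ j'} eq = cong inj₂ (proj₂ twinFree j j' λ i →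
      trans (sym (adjacency i j)) (trans (cong (E B (xmap i)) (inj₂-injective eq)) (adjacency i j')))
    adj : ∀ u v → bipAdj B (Sum.map xmap ymap u) (Sum.map xmap ymap v) ⇔ bipAdj P u v
    adj (inj₁ i) (inj₂ j) = mk⇔ (trans (sym (adjacency i j))) (trans (adjacency i j))
    adj (inj₂ j) (inj₁ i) = mk⇔ (trans (sym (adjacency i j))) (trans (adjacency i j))
    adj (inj₁ _) (inj₁ _) = ⇔.refl
    adj (inj₂ _) (inj₂ _) = ⇔.refl

  occurrence-XP7 : XP7 P → XP7 B
  occurrence-XP7 (p , (x₀ , e₀) , (x₆ , e₆)) =
    InducedSubgraph.path occurrence-induced p ,
    (xmap x₀ , cong (Sum.map xmap ymap) e₀) , (xmap x₆ , cong (Sum.map xmap ymap) e₆)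

module _ (B : Bipartite) where

  bipAdj? : ∀ u v → Dec (bipAdj B u v)
  bipAdj? (inj₁ x) (inj₂ y) = E B x y ≟ᵇ true
  bipAdj? (inj₂ y) (inj₁ x) = E B x y ≟ᵇ true
  bipAdj? (inj₁ _) (inj₁ _) = no λ ()
  bipAdj? (inj₂ _) (inj₂ _) = no λ ()

  InducedAlong : ∀ {L} → (Fin L → Fin L → Set) → (Fin L → V (graphOf B)) → Set
  InducedAlong R c = Injective _≡_ _≡_ c × ∀ i j → bipAdj B (c i) (c j) ⇔ R i j

  inducedAlong? : ∀ {L} {R : Fin L → Fin L → Set} → (∀ i j → Dec (R i j)) →
                  ∀ c → Dec (InducedAlong R c)
  inducedAlong? R? c = injective? ×-dec all? λ i → all? λ j → bipAdj? (c i) (c j) ⇔? R? i j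
    where
    injective? : Dec (Injective _≡_ _≡_ c)
    injective? = map′ (λ h {i} {j} → h i j) (λ h i j → h)
      (all? λ i → all? λ j → ≡-dec _≟ᶠ_ _≟ᶠ_ (c i) (c j) →-dec (i ≟ᶠ j))

cycAdj? : ∀ {L} (i j : Fin L) → Dec (CycAdj L i j)
cycAdj? {L} i j = next? i j ⊎-dec next? j i
  where
  next? : ∀ i j → Dec (CycNext L i j)
  next? i j = (suc (toℕ i) ≟ toℕ j) ⊎-dec ((suc (toℕ i) ≟ L) ×-dec (toℕ j ≟ 0))

pathAdj? : ∀ {L} (i j : Fin L) → Dec (PathAdj L i j)
pathAdj? i j = (suc (toℕ i) ≟ toℕ j) ⊎-dec (suc (toℕ j) ≟ toℕ i)

module _ {P B : Bipartite} {L} {R : Fin L → Fin L → Set}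
  (p : Fin L → V (graphOf P)) (p-induced : InducedAlong P R p)
  (c : Fin L → V (graphOf B)) (c-induced : InducedAlong B R c)
  (xpos : Fin (m P) → Fin L) (ypos : Fin (n P) → Fin L)
  (p-xpos : ∀ i → p (xpos i) ≡ inj₁ i) (p-ypos : ∀ j → p (ypos j) ≡ inj₂ j)
  (xmap : Fin (m P) → Fin (m B)) (ymap : Fin (n P) → Fin (n B))
  (c-xpos : ∀ i → c (xpos i) ≡ inj₁ (xmap i)) (c-ypos : ∀ j → c (ypos j) ≡ inj₂ (ymap j))
  where

  aligned-occurrence : Occurrence P B
  aligned-occurrence = record { xmap = xmap ; ymap = ymap ; adjacency = λ i j → ⇔→≡ (edge i j) }
    where
    edge : ∀ i j → E B (xmap i) (ymap j) ≡ true ⇔ E P i j ≡ true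
    edge i j = ⇔.trans (subst₂ (λ u v → bipAdj B u v ⇔ R (xpos i) (ypos j)) (c-xpos i) (c-ypos j)
                                (proj₂ c-induced (xpos i) (ypos j)))
                       (⇔.sym (subst₂ (λ u v → bipAdj P u v ⇔ R (xpos i) (ypos j)) (p-xpos i) (p-ypos j)
                                       (proj₂ p-induced (xpos i) (ypos j))))

pattern₃ : ∀ {k} → (Fin k → Fin 3 → Bool) → Bipartite
pattern₃ {k} ρ = record { m = k ; n = 3 ; E = ρ }

perfectMatching₃ : Bipartite
perfectMatching₃ = pattern₃ λ i j → does (i ≟ᶠ j)

mirror-perfectMatching₃-C₆ : InducedCycle (graphOf (mir perfectMatching₃)) 6
mirror-perfectMatching₃-C₆ = c , from-yes (inducedAlong? (mir perfectMatching₃) cycAdj? c)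
  where
  c : Fin 6 → Fin 3 ⊎ Fin 3
  c = lookup (inj₂ (# 0) ∷ inj₁ (# 1) ∷ inj₂ (# 2) ∷ inj₁ (# 0) ∷ inj₂ (# 1) ∷ inj₁ (# 2) ∷ [])

pathPattern₇ : Bipartite
pathPattern₇ = pattern₃ λ i j → lookup (lookup rows i) j
  where
  rows : Vec (Vec Bool 3) 4
  rows = (true ∷ false ∷ false ∷ []) ∷ (true ∷ true ∷ false ∷ [])
       ∷ (false ∷ true ∷ true ∷ []) ∷ (false ∷ false ∷ true ∷ []) ∷ []

pathPattern₇-XP7 : XP7 pathPattern₇
pathPattern₇-XP7 = (c , from-yes (inducedAlong? pathPattern₇ pathAdj? c)) , (# 0 , refl) , (# 3 , refl)
  where
  c : Fin 7 → Fin 4 ⊎ Fin 3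
  c = lookup ( inj₁ (# 0) ∷ inj₂ (# 0) ∷ inj₁ (# 1) ∷ inj₂ (# 1)
             ∷ inj₁ (# 2) ∷ inj₂ (# 2) ∷ inj₁ (# 3) ∷ [])

mirror-perfectMatching₃-twinFree : TwinFree (mir perfectMatching₃)
mirror-perfectMatching₃-twinFree = from-yes (twinFree? (mir perfectMatching₃))

pathPattern₇-twinFree : TwinFree pathPattern₇
pathPattern₇-twinFree = from-yes (twinFree? pathPattern₇)

module Neighbourhoods (B : Bipartite) where

  N⟨_⟩ : Fin (n B) → Subset (m B)
  N⟨ y ⟩ = tabulate λ x → E B x y

  ∈-N⟨⟩ : ∀ {x y} → x ∈ N⟨ y ⟩ ⇔ E B x y ≡ true
  ∈-N⟨⟩ {x} {y} = mk⇔
    (λ x∈ → trans (sym (lookup∘tabulate _ x)) ([]=⇒lookup x∈))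
    (λ exy → lookup⇒[]= x _ (trans (lookup∘tabulate _ x) exy))

  _≼_ : Fin (n B) → Fin (n B) → Set
  u ≼ v = N⟨ u ⟩ ⊆ N⟨ v ⟩

  size : Fin (n B) → Fin (suc (m B))
  size y = fromℕ< (s≤s (∣p∣≤n N⟨ y ⟩))

  rank : Fin (n B) → ℕ
  rank y = toℕ (combine (size y) y)

  rank< : ∀ y → rank y < suc (m B) * n B
  rank< y = toℕ<n (combine (size y) y)

  rank-injective : ∀ {u v} → rank u ≡ rank v → u ≡ v
  rank-injective {u} {v} eq = combine-injectiveʳ (size u) u (size v) v (toℕ-injective eq)

  rank-linear : ∀ {u v} → rank u < rank v → v ≼ u → u ≼ v
  rank-linear {u} {v} ru<rv v≼u with N⟨ u ⟩ ⊆? N⟨ v ⟩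
  ... | yes u≼v = u≼v
  ... | no u⋠v with ⊈-witness u⋠v
  ...   | x , x∈u , x∉v = ⊥-elim (<-asym ru<rv (combine-monoˡ-< v u sizeᵥ<sizeᵤ))
    where
    sizeᵥ<sizeᵤ : toℕ (size v) < toℕ (size u)
    sizeᵥ<sizeᵤ = subst₂ _<_ (sym (toℕ-fromℕ< _)) (sym (toℕ-fromℕ< _))
                         (p⊂q⇒∣p∣<∣q∣ (v≼u , x , x∈u , x∉v))

  HasRow : (p q r : Fin (n B)) (a b c : Bool) → Set
  HasRow p q r a b c = ∃ λ x → E B x p ≡ a × E B x q ≡ b × E B x r ≡ c

  module _ {p q r : Fin (n B)} {a b c : Bool} where
    HasRow-swap₁₂ : HasRow p q r a b c → HasRow q p r b a c
    HasRow-swap₁₂ (x , ep , eq , er) = x , eq , ep , er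

    HasRow-swap₂₃ : HasRow p q r a b c → HasRow p r q a c b
    HasRow-swap₂₃ (x , ep , eq , er) = x , ep , er , eq

    HasRow-swap₁₃ : HasRow p q r a b c → HasRow r q p c b a
    HasRow-swap₁₃ (x , ep , eq , er) = x , er , eq , ep

  private-or-shared : ∀ {p q} → N⟨ p ⟩ ⊈ N⟨ q ⟩ → ∀ r →
    HasRow p q r true false false ⊎ HasRow p q r true false true
  private-or-shared p⋢q r with ⊈-witness p⋢q
  ... | x , x∈p , x∉q with E B x r in exr
  ...   | false = inj₁ (x , to ∈-N⟨⟩ x∈p , ¬-not (x∉q ∘ from ∈-N⟨⟩) , exr)
  ...   | true  = inj₂ (x , to ∈-N⟨⟩ x∈p , ¬-not (x∉q ∘ from ∈-N⟨⟩) , exr)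

  private-or-bothShared : ∀ {p q r} → N⟨ p ⟩ ⊈ N⟨ q ⟩ → N⟨ p ⟩ ⊈ N⟨ r ⟩ →
    HasRow p q r true false false ⊎ (HasRow p q r true true false × HasRow p q r true false true)
  private-or-bothShared {p} {q} {r} p⋢q p⋢r with private-or-shared p⋢q r | private-or-shared p⋢r q
  ... | inj₁ onlyP    | _            = inj₁ onlyP
  ... | inj₂ _       | inj₁ onlyP   = inj₁ (HasRow-swap₂₃ onlyP)
  ... | inj₂ sharedR | inj₂ sharedQ  = inj₂ (HasRow-swap₂₃ sharedQ , sharedR)

  rowsOccurrence : ∀ {k} (ρ : Fin k → Fin 3 → Bool) {p q r} →
    (∀ i → HasRow p q r (ρ i (# 0)) (ρ i (# 1)) (ρ i (# 2))) → Occurrence (pattern₃ ρ) B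
  rowsOccurrence ρ {p} {q} {r} rows =
    record { xmap = proj₁ ∘ rows ; ymap = lookup (p ∷ q ∷ r ∷ []) ; adjacency = adjacency }
    where
    adjacency : ∀ i j → E B (proj₁ (rows i)) (lookup (p ∷ q ∷ r ∷ []) j) ≡ ρ i j
    adjacency i zero             = proj₁ (proj₂ (rows i))
    adjacency i (suc zero)       = proj₁ (proj₂ (proj₂ (rows i)))
    adjacency i (suc (suc zero)) = proj₂ (proj₂ (proj₂ (rows i)))

  module _ {u v w : Fin (n B)} where
    matchingRows⇒mirror-C₆ :
      HasRow u v w true false false → HasRow u v w false true false → HasRow u v w false false true →
      InducedCycle (graphOf (mir B)) 6
    matchingRows⇒mirror-C₆ r₀ r₁ r₂ =
      InducedSubgraph.cycle (occurrence-induced mirror-perfectMatching₃-twinFree (mirror occurrence))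
        mirror-perfectMatching₃-C₆
      where
      occurrence : Occurrence perfectMatching₃ B
      occurrence = rowsOccurrence _ λ { zero → r₀ ; (suc zero) → r₁ ; (suc (suc zero)) → r₂ }

    sharedRows⇒C₆ :
      HasRow u v w false true true → HasRow u v w true false true → HasRow u v w true true false →
      InducedCycle (graphOf B) 6
    sharedRows⇒C₆ r₀ r₁ r₂ =
      InducedSubgraph.cycle (occurrence-induced mirror-perfectMatching₃-twinFree occurrence)
        mirror-perfectMatching₃-C₆
      where
      occurrence : Occurrence (mir perfectMatching₃) B
      occurrence = rowsOccurrence _ λ { zero → r₀ ; (suc zero) → r₁ ; (suc (suc zero)) → r₂ }

    pathRows⇒XP7 :
      HasRow u v w true false false → HasRow u v w true true false →
      HasRow u v w false true true → HasRow u v w false false true → XP7 B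
    pathRows⇒XP7 r₀ r₁ r₂ r₃ = occurrence-XP7 pathPattern₇-twinFree (rowsOccurrence _ λ
      { zero → r₀ ; (suc zero) → r₁ ; (suc (suc zero)) → r₂ ; (suc (suc (suc zero))) → r₃ })
      pathPattern₇-XP7

  -- Each of u, v, w has a private neighbour or shares a
  -- neighbour with each of the other two. Private neighbours for all three give 3K₂,
  -- shared ones for all three pairs give C₆; otherwise the vertex lacking a private
  -- neighbour is the middle of an X-P₇.
  width≤2-of-ACB : ACB B → ¬ XP7 B → Width≤2 _≼_
  width≤2-of-ACB (chordal , mirrorChordal) noXP7 u v w (u⋢v , v⋢u) (v⋢w , w⋢v) (u⋢w , w⋢u)
    with private-or-bothShared u⋢v u⋢w
       | Sum.map HasRow-swap₁₂ (Product.map HasRow-swap₁₂ HasRow-swap₁₂) (private-or-bothShared v⋢u v⋢w)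
       | Sum.map HasRow-swap₁₃ (Product.map HasRow-swap₁₃ HasRow-swap₁₃) (private-or-bothShared w⋢v w⋢u)
  ... | inj₁ o₁ | inj₁ o₂ | inj₁ o₃ = mirrorChordal 3 ≤-refl (matchingRows⇒mirror-C₆ o₁ o₂ o₃)
  ... | inj₂ (s₁₂ , s₁₃) | inj₂ (_ , s₂₃) | _ = chordal 3 ≤-refl (sharedRows⇒C₆ s₂₃ s₁₃ s₁₂)
  ... | inj₂ (s₁₂ , s₁₃) | inj₁ _ | inj₂ (s₂₃ , _) = chordal 3 ≤-refl (sharedRows⇒C₆ s₂₃ s₁₃ s₁₂)
  ... | inj₁ _ | inj₂ (s₁₂ , s₂₃) | inj₂ (_ , s₁₃) = chordal 3 ≤-refl (sharedRows⇒C₆ s₂₃ s₁₃ s₁₂)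
  ... | inj₂ (s₁₂ , s₁₃) | inj₁ o₂ | inj₁ o₃ =
    noXP7 (pathRows⇒XP7 (HasRow-swap₁₂ o₂) (HasRow-swap₁₂ s₁₂) (HasRow-swap₁₂ s₁₃) (HasRow-swap₁₂ o₃))
  ... | inj₁ o₁ | inj₂ (s₁₂ , s₂₃) | inj₁ o₃ = noXP7 (pathRows⇒XP7 o₁ s₁₂ s₂₃ o₃)
  ... | inj₁ o₁ | inj₁ o₂ | inj₂ (s₂₃ , s₁₃) =
    noXP7 (pathRows⇒XP7 (HasRow-swap₂₃ o₁) (HasRow-swap₂₃ s₁₃) (HasRow-swap₂₃ s₂₃) (HasRow-swap₂₃ o₂))

module _ (B : Bipartite) where

  splitX-interval :
    (pos : Fin (n B) → ℕ) → (∀ {y y′} → pos y ≡ pos y′ → y ≡ y′) →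
    (lft rgt : Fin (m B) → ℕ) (mid : ℕ) → (∀ x → lft x ≤ mid) → (∀ x → mid ≤ rgt x) →
    (∀ x y → E B x y ≡ true ⇔ (lft x ≤ pos y × pos y ≤ rgt x)) →
    IsIntervalGraph (splitX B)
  splitX-interval pos pos-injective lft rgt mid lft≤mid mid≤rgt meets = l , r , l≤r , adj
    where
    l r : Fin (m B) ⊎ Fin (n B) → ℕ
    l = Sum.[ lft , pos ]
    r = Sum.[ rgt , pos ]
    l≤r : ∀ v → l v ≤ r v
    l≤r (inj₁ x) = ≤-trans (lft≤mid x) (mid≤rgt x)
    l≤r (inj₂ y) = ≤-refl
    adj : ∀ u v → u ≢ v → splitAdj B u v ⇔ (l u ≤ r v × l v ≤ r u)
    adj (inj₁ x) (inj₁ x′) x≢x′ = mk⇔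
      (λ _ → ≤-trans (lft≤mid x) (mid≤rgt x′) , ≤-trans (lft≤mid x′) (mid≤rgt x))
      (λ _ → x≢x′ ∘ cong inj₁)
    adj (inj₁ x) (inj₂ y) _ = meets x y
    adj (inj₂ y) (inj₁ x) _ = ⇔.trans (meets x y) (mk⇔ swap swap)
    adj (inj₂ y) (inj₂ y′) y≢y′ = mk⇔ (λ ())
      (λ (p≤p′ , p′≤p) → y≢y′ (cong inj₂ (pos-injective (≤-antisym p≤p′ p′≤p))))

module TwoChainLayout
  (B : Bipartite) (colour : Fin (n B) → Bool)
  (rank : Fin (n B) → ℕ) (rank-injective : ∀ {y y′} → rank y ≡ rank y′ → y ≡ y′)
  (D : ℕ) (rank< : ∀ y → rank y < D)
  (monotone : ∀ {x y y′} → colour y ≡ colour y′ → rank y ≤ rank y′ →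
              E B x y ≡ true → E B x y′ ≡ true)
  where

  -- Along chain c, the neighbours of x form a final segment in rank order;
  -- threshold c x is the rank where that segment starts.
  nonNeighbourBound : Bool → Fin (m B) → Fin (n B) → ℕ
  nonNeighbourBound c x y = if E B x y then 0 else if does (colour y ≟ᵇ c) then suc (rank y) else 0

  threshold : Bool → Fin (m B) → ℕ
  threshold c x = maxOver (nonNeighbourBound c x)

  threshold≤D : ∀ c x → threshold c x ≤ D
  threshold≤D c x = maxOver-lub nonNeighbourBound≤D
    where
    nonNeighbourBound≤D : ∀ y → nonNeighbourBound c x y ≤ D
    nonNeighbourBound≤D y with E B x y | colour y ≟ᵇ c
    ... | true  | _     = z≤n
    ... | false | yes _ = rank< y
    ... | false | no _  = z≤n

  threshold-correct : ∀ {c x y} → colour y ≡ c → E B x y ≡ true ⇔ threshold c x ≤ rank y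
  threshold-correct {c} {x} {y} refl = mk⇔ (λ exy → maxOver-lub (nonNeighbourBound≤rank exy)) adjacent
    where
    nonNeighbourBound≤rank : E B x y ≡ true → ∀ y′ → nonNeighbourBound c x y′ ≤ rank y
    nonNeighbourBound≤rank exy y′ with E B x y′ in exy′ | colour y′ ≟ᵇ c
    ... | true  | _         = z≤n
    ... | false | no _      = z≤n
    ... | false | yes y′≡c  = ≰⇒> λ ry≤ry′ →
      case trans (sym (monotone (sym y′≡c) ry≤ry′ exy)) exy′ of λ ()
    adjacent : threshold c x ≤ rank y → E B x y ≡ true
    adjacent θ≤ry with E B x y in exy | ≤-maxOver (nonNeighbourBound c x) y
    ... | true  | _ = refl
    ... | false | e≤θ rewrite dec-true (colour y ≟ᵇ c) refl =
      ⊥-elim (<-irrefl refl (≤-trans e≤θ θ≤ry))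

  pos : Fin (n B) → ℕ
  pos y = if colour y then rank y else D + D ∸ rank y

  lft rgt : Fin (m B) → ℕ
  lft = threshold true
  rgt x = D + D ∸ threshold false x

  D≤2D∸ : ∀ {k} → k ≤ D → D ≤ D + D ∸ k
  D≤2D∸ k≤D = ≤-trans (≤-reflexive (sym (m+n∸n≡m D D))) (∸-monoʳ-≤ (D + D) k≤D)

  ≤2D : ∀ {k} → k ≤ D → k ≤ D + D
  ≤2D k≤D = ≤-trans k≤D (m≤m+n D D)

  pos-injective : ∀ {y y′} → pos y ≡ pos y′ → y ≡ y′
  pos-injective {y} {y′} eq with colour y | colour y′
  ... | true  | true  = rank-injective eq
  ... | false | false =
    rank-injective (∸-cancelˡ-≡ (≤2D (<⇒≤ (rank< y))) (≤2D (<⇒≤ (rank< y′))) eq)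
  ... | true  | false = ⊥-elim (<-irrefl eq (<-≤-trans (rank< y) (D≤2D∸ (<⇒≤ (rank< y′)))))
  ... | false | true  = ⊥-elim (<-irrefl (sym eq) (<-≤-trans (rank< y′) (D≤2D∸ (<⇒≤ (rank< y)))))

  meets : ∀ x y → E B x y ≡ true ⇔ (lft x ≤ pos y × pos y ≤ rgt x)
  meets x y with colour y in cy
  ... | true  = ⇔.trans (threshold-correct cy)
      (mk⇔ (_, ≤-trans (<⇒≤ (rank< y)) (D≤2D∸ (threshold≤D false x))) proj₁)
  ... | false = ⇔.trans (threshold-correct cy)
      (mk⇔ (λ θ≤ry → ≤-trans (threshold≤D true x) (D≤2D∸ (<⇒≤ (rank< y))) ,
                     ∸-monoʳ-≤ (D + D) θ≤ry)
           (∸-cancelʳ-≤ (≤2D (threshold≤D false x)) ∘ proj₂))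

  interval : IsIntervalGraph (splitX B)
  interval = splitX-interval B pos pos-injective lft rgt D
                             (threshold≤D true) (D≤2D∸ ∘ threshold≤D false) meets

noXP7⇒interval : ∀ B → ACB B → ¬ XP7 B → IsIntervalGraph (splitX B)
noXP7⇒interval B acb noXP7 =
  TwoChainLayout.interval B (proj₁ (twoChainCover D rank<)) rank rank-injective D rank< monotone
  where
  open Neighbourhoods B
  open TwoChains _≼_ (λ u v → N⟨ u ⟩ ⊆? N⟨ v ⟩) ⊆-refl ⊆-trans (width≤2-of-ACB acb noXP7)
                 rank rank-injective rank-linear
  D : ℕ
  D = suc (m B) * n B
  monotone : ∀ {x y y′} → proj₁ (twoChainCover D rank<) y ≡ proj₁ (twoChainCover D rank<) y′ →
             rank y ≤ rank y′ → E B x y ≡ true → E B x y′ ≡ true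
  monotone same ry≤ry′ = to ∈-N⟨⟩ ∘ chains-monotone D rank< same ry≤ry′ ∘ from ∈-N⟨⟩

module _ {B : Bipartite} where

  across-from-X : ∀ {u x v} → u ≡ inj₁ x → bipAdj B u v → ∃ λ y → v ≡ inj₂ y
  across-from-X {v = inj₂ y} refl _ = y , refl

  across-from-Y : ∀ {u y v} → u ≡ inj₂ y → bipAdj B u v → ∃ λ x → v ≡ inj₁ x
  across-from-Y {v = inj₁ x} refl _ = x , refl

  XP7⇒pathOccurrence : XP7 B → Occurrence pathPattern₇ B
  XP7⇒pathOccurrence ((c , c-induced) , (x₀ , c₀) , (x₃ , c₆)) =
    aligned-occurrence (proj₁ pattern-path) (proj₂ pattern-path) c c-induced xpos ypos
      (λ { zero → refl ; (suc zero) → refl ; (suc (suc zero)) → refl ; (suc (suc (suc zero))) → refl })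
      (λ { zero → refl ; (suc zero) → refl ; (suc (suc zero)) → refl })
      xmap ymap
      (λ { zero → c₀ ; (suc zero) → proj₂ at₂
         ; (suc (suc zero)) → proj₂ at₄ ; (suc (suc (suc zero))) → c₆ })
      (λ { zero → proj₂ at₁ ; (suc zero) → proj₂ at₃ ; (suc (suc zero)) → proj₂ at₅ })
    where
    pattern-path : InducedPath (graphOf pathPattern₇) 7
    pattern-path = proj₁ pathPattern₇-XP7
    xpos : Fin 4 → Fin 7
    xpos = lookup (# 0 ∷ # 2 ∷ # 4 ∷ # 6 ∷ [])
    ypos : Fin 3 → Fin 7
    ypos = lookup (# 1 ∷ # 3 ∷ # 5 ∷ [])
    edge : ∀ i j → suc (toℕ i) ≡ toℕ j → bipAdj B (c i) (c j)
    edge i j i→j = from (proj₂ c-induced i j) (inj₁ i→j)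
    at₁ : ∃ λ y → c (# 1) ≡ inj₂ y
    at₁ = across-from-X c₀ (edge (# 0) (# 1) refl)
    at₂ : ∃ λ x → c (# 2) ≡ inj₁ x
    at₂ = across-from-Y (proj₂ at₁) (edge (# 1) (# 2) refl)
    at₃ : ∃ λ y → c (# 3) ≡ inj₂ y
    at₃ = across-from-X (proj₂ at₂) (edge (# 2) (# 3) refl)
    at₄ : ∃ λ x → c (# 4) ≡ inj₁ x
    at₄ = across-from-Y (proj₂ at₃) (edge (# 3) (# 4) refl)
    at₅ : ∃ λ y → c (# 5) ≡ inj₂ y
    at₅ = across-from-X (proj₂ at₄) (edge (# 4) (# 5) refl)
    xmap : Fin 4 → Fin (m B)
    xmap = lookup (x₀ ∷ proj₁ at₂ ∷ proj₁ at₄ ∷ x₃ ∷ [])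
    ymap : Fin 3 → Fin (n B)
    ymap = lookup (proj₁ at₁ ∷ proj₁ at₃ ∷ proj₁ at₅ ∷ [])

module IntervalModel {B : Bipartite} (model : IsIntervalGraph (splitX B)) where

  l r : Fin (m B) ⊎ Fin (n B) → ℕ
  l = proj₁ model
  r = proj₁ (proj₂ model)

  l≤r : ∀ v → l v ≤ r v
  l≤r = proj₁ (proj₂ (proj₂ model))

  intersect : ∀ {u v} → u ≢ v → splitAdj B u v ⇔ (l u ≤ r v × l v ≤ r u)
  intersect {u} {v} = proj₂ (proj₂ (proj₂ model)) u v

  _≺_ : Fin (n B) → Fin (n B) → Set
  y ≺ y′ = r (inj₂ y) < l (inj₂ y′)

  Y-ordered : ∀ {y y′} → y ≢ y′ → y ≺ y′ ⊎ y′ ≺ y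
  Y-ordered {y} {y′} y≢y′ with l (inj₂ y) ≤? r (inj₂ y′) | l (inj₂ y′) ≤? r (inj₂ y)
  ... | no  ≰ | _     = inj₂ (≰⇒> ≰)
  ... | yes _ | no  ≰ = inj₁ (≰⇒> ≰)
  ... | yes ≤₁ | yes ≤₂ = ⊥-elim (from (intersect (y≢y′ ∘ inj₂-injective)) (≤₁ , ≤₂))

  Between : Fin (n B) → Fin (n B) → Fin (n B) → Set
  Between a b c = (a ≺ b × b ≺ c) ⊎ (c ≺ b × b ≺ a)

  one-between : ∀ {a b c} → a ≢ b → b ≢ c → a ≢ c → Between b a c ⊎ Between a b c ⊎ Between a c b
  one-between a≢b b≢c a≢c with Y-ordered a≢b | Y-ordered b≢c | Y-ordered a≢c
  ... | inj₁ a≺b | inj₁ b≺c | _        = inj₂ (inj₁ (inj₁ (a≺b , b≺c)))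
  ... | inj₂ b≺a | inj₂ c≺b | _        = inj₂ (inj₁ (inj₂ (c≺b , b≺a)))
  ... | inj₁ a≺b | inj₂ c≺b | inj₁ a≺c = inj₂ (inj₂ (inj₁ (a≺c , c≺b)))
  ... | inj₁ a≺b | inj₂ c≺b | inj₂ c≺a = inj₁ (inj₂ (c≺a , a≺b))
  ... | inj₂ b≺a | inj₁ b≺c | inj₁ a≺c = inj₁ (inj₁ (b≺a , a≺c))
  ... | inj₂ b≺a | inj₁ b≺c | inj₂ c≺a = inj₂ (inj₂ (inj₂ (b≺c , c≺a)))

  -- x reaches a from the left of b and x′ reaches c from its right, yet their
  -- intervals meet, so one of them covers b.
  left-right-blocked : ∀ {a b c x x′} → a ≺ b → b ≺ c →
    E B x a ≡ true → E B x b ≡ false → E B x′ c ≡ true → E B x′ b ≡ false → x ≢ x′ → ⊥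
  left-right-blocked {a} {b} {c} {x} {x′} a≺b b≺c exa exb ex′c ex′b x≢x′
    with l (inj₂ b) ≤? r (inj₁ x)
  ... | yes lb≤rx = case trans (sym (from (intersect (λ ())) (lx≤rb , lb≤rx))) exb of λ ()
    where
    lx≤rb : l (inj₁ x) ≤ r (inj₂ b)
    lx≤rb = ≤-trans (proj₁ (to (intersect (λ ())) exa)) (≤-trans (<⇒≤ a≺b) (l≤r (inj₂ b)))
  ... | no lb≰rx = case trans (sym (from (intersect (λ ())) (lx′≤rb , lb≤rx′))) ex′b of λ ()
    where
    lx′≤rb : l (inj₁ x′) ≤ r (inj₂ b)
    lx′≤rb = ≤-trans (proj₂ (to (intersect (x≢x′ ∘ inj₁-injective)) x≢x′))
                     (≤-trans (<⇒≤ (≰⇒> lb≰rx)) (l≤r (inj₂ b)))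
    lb≤rx′ : l (inj₂ b) ≤ r (inj₁ x′)
    lb≤rx′ = ≤-trans (l≤r (inj₂ b)) (≤-trans (<⇒≤ b≺c) (proj₂ (to (intersect (λ ())) ex′c)))

  between-blocked : ∀ {a b c x x′} → Between a b c →
    E B x a ≡ true → E B x b ≡ false → E B x′ c ≡ true → E B x′ b ≡ false → x ≢ x′ → ⊥
  between-blocked (inj₁ (a≺b , b≺c)) exa exb ex′c ex′b x≢x′ =
    left-right-blocked a≺b b≺c exa exb ex′c ex′b x≢x′
  between-blocked (inj₂ (c≺b , b≺a)) exa exb ex′c ex′b x≢x′ =
    left-right-blocked c≺b b≺a ex′c ex′b exa exb (x≢x′ ∘ sym)

  distinct-X : ∀ {x x′ y} → E B x y ≡ true → E B x′ y ≡ false → x ≢ x′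
  distinct-X exy ex′y refl = case trans (sym exy) ex′y of λ ()

  distinct-Y : ∀ {x y y′} → E B x y ≡ true → E B x y′ ≡ false → y ≢ y′
  distinct-Y exy exy′ refl = case trans (sym exy) exy′ of λ ()

  module _ (occ : Occurrence pathPattern₇ B) where
    open Occurrence occ renaming (adjacency to sees)

    no-pathOccurrence : ⊥
    no-pathOccurrence
      with one-between (distinct-Y (sees (# 0) (# 0)) (sees (# 0) (# 1)))
                       (distinct-Y (sees (# 1) (# 1)) (sees (# 1) (# 2)))
                       (distinct-Y (sees (# 0) (# 0)) (sees (# 0) (# 2)))
    ... | inj₁ y₀-between =
      between-blocked y₀-between (sees (# 2) (# 1)) (sees (# 2) (# 0)) (sees (# 3) (# 2)) (sees (# 3) (# 0))
                      (distinct-X (sees (# 2) (# 1)) (sees (# 3) (# 1)))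
    ... | inj₂ (inj₁ y₁-between) =
      between-blocked y₁-between (sees (# 0) (# 0)) (sees (# 0) (# 1)) (sees (# 3) (# 2)) (sees (# 3) (# 1))
                      (distinct-X (sees (# 0) (# 0)) (sees (# 3) (# 0)))
    ... | inj₂ (inj₂ y₂-between) =
      between-blocked y₂-between (sees (# 0) (# 0)) (sees (# 0) (# 2)) (sees (# 1) (# 1)) (sees (# 1) (# 2))
                      (distinct-X (sees (# 1) (# 1)) (sees (# 0) (# 1)) ∘ sym)

corollary5 : (B : Bipartite) → ACB B → IsIntervalGraph (splitX B) ⇔ (¬ XP7 B)
corollary5 B acb = mk⇔
  (λ model → IntervalModel.no-pathOccurrence model ∘ XP7⇒pathOccurrence)
  (noXP7⇒interval B acb)
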